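{- Let $\Gamma,\Delta,\Gamma_1,\Delta_1,\dots,\Gamma_n,\Delta_n$ ($n\ge1$) be finite sets of unlabelled formulas such that the rule with premises $\Gamma_1\Rightarrow\Delta_1,\dots,\Gamma_n\Rightarrow\Delta_n$ and conclusion $\Gamma\Rightarrow\Delta$ is sound. Let $A=\Gamma\cup\Delta\cup\Gamma_1\cup\Delta_1\cup\dots\cup\Gamma_n\cup\Delta_n$ and let $\sigma$ be a configuration that is free w.r.t. $A$. Then the rule with premises $\sigma:\Gamma_1\Rightarrow\sigma:\Delta_1,\dots,\sigma:\Gamma_n\Rightarrow\sigma:\Delta_n$ and conclusion $\sigma:\Gamma\Rightarrow\sigma:\Delta$ is sound.
   Context: Let $\mathit{Eval}$ be a set of evaluations and $\mathit{Conf}$ a set of configurations. There is a class of unlabelled formulas $\phi$ with a satisfaction relation $\rho\models\phi$ for $\rho\in\mathit{Eval}$ (assumed well defined, e.g. from some particular dynamic logic), and for each configuration $\sigma$ and unlabelled $\phi$ there is a labelled formula $\sigma:\phi$ with a satisfaction relation $\rho\models\sigma:\phi$. For a set $A$ of unlabelled formulas, $\sigma:A=\{\sigma:\phi\mid\phi\in A\}$. A sequent $\Gamma\Rightarrow\Delta$ is valid if for every $\rho\in\mathit{Eval}$, if $\rho\models\phi$ for all $\phi\in\Gamma$ then $\rho\models\psi$ for some $\psi\in\Delta$. A rule is sound if validity of all its premises implies validity of its conclusion. For $\rho,\rho'\in\mathit{Eval}$, $\sigma\in\mathit{Conf}$ and a set $A$ of unlabelled formulas, write $(\rho,\sigma)\simeq_A\rho'$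 if for every $\phi\in A$: $\rho\models\sigma:\phi$ iff $\rho'\models\phi$. A configuration $\sigma$ is free w.r.t. $A$ if (1) for every $\rho\in\mathit{Eval}$ there is $\rho'\in\mathit{Eval}$ with $(\rho,\sigma)\simeq_A\rho'$, and (2) for every $\rho\in\mathit{Eval}$ there is $\rho'\in\mathit{Eval}$ with $(\rho',\sigma)\simeq_A\rho$. -}

module Defs where

open import Level using (Level; _⊔_; suc)
open import Data.Nat using (ℕ; _≤_)
open import Data.Fin using (Fin)
open import Data.List using (List; map; _++_; concat)
open import Data.List.Membership.Propositional using (_∈_)
open import Data.Product using (Σ; ∃; _×_)
open import Function.Bundles using (_⇔_)

record Logic (a : Level) : Set (suc a) where
  field
    Eval  : Set a
    Conf  : Set a
    Form  : Set a
    LForm : Set a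
    _∶_   : Conf → Form → LForm
    _⊨_   : Eval → Form → Set a
    _⊨ₗ_  : Eval → LForm → Set a

module _ {a : Level} (L : Logic a) where
  open Logic L

  -- Generic sequent validity for formulas F with satisfaction sat.
  -- Finite sets of formulas are represented by lists.
  ValidGen : {F : Set a} → (Eval → F → Set a) → List F → List F → Set a
  ValidGen sat Γ Δ =
    (ρ : Eval) → (∀ {φ} → φ ∈ Γ → sat ρ φ) → ∃ λ ψ → ψ ∈ Δ × sat ρ ψ

  Valid : List Form → List Form → Set a
  Valid = ValidGen _⊨_

  ValidL : List LForm → List LForm → Set a
  ValidL = ValidGen _⊨ₗ_

  label : Conf → List Form → List LForm
  label σ = map (σ ∶_)

  SoundRule : {F : Set a} → (Eval → F → Set a) → (n : ℕ) →
              (Fin n → List F) → (Fin n → List F) → List F → List F → Set a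
  SoundRule sat n Γs Δs Γ Δ = (∀ i → ValidGen sat (Γs i) (Δs i)) → ValidGen sat Γ Δ

  Sim : Eval → Conf → List Form → Eval → Set a
  Sim ρ σ A ρ' = ∀ {φ} → φ ∈ A → (ρ ⊨ₗ (σ ∶ φ)) ⇔ (ρ' ⊨ φ)

  Free : Conf → List Form → Set a
  Free σ A = ((ρ : Eval) → ∃ λ ρ' → Sim ρ σ A ρ')
           × ((ρ : Eval) → ∃ λ ρ' → Sim ρ' σ A ρ)

  allFormulas : (n : ℕ) → (Fin n → List Form) → (Fin n → List Form) →
                List Form → List Form → List Form
  allFormulas n Γs Δs Γ Δ =
    Γ ++ Δ ++ concat (Data.List.map (λ i → Γs i ++ Δs i) (Data.List.allFin n))

{-# OPTIONS --safe #-}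
module Submission where

open import Defs
open import Level using (Level)
open import Data.Nat using (ℕ; _≤_)
open import Data.Fin using (Fin)
open import Data.List using (List; _++_)
open import Data.List.Membership.Propositional using (_∈_)
open import Data.List.Membership.Propositional.Properties
  using (∈-map⁺; ∈-map⁻; ∈-concat⁺′; ∈-allFin)
open import Data.List.Relation.Binary.Subset.Propositional using (_⊆_)
open import Data.List.Relation.Binary.Subset.Propositional.Properties
  using (⊆-trans; xs⊆xs++ys; xs⊆ys++xs)
open import Data.Product using (∃; _×_; _,_)
open import Function.Bundles using (_⇔_; mk⇔; Equivalence)
open import Relation.Binary.PropositionalEquality using (refl)

-- Proof idea: if (ρ, σ) ≃_A ρ', then ρ satisfies σ:φ exactly when ρ' satisfies φ,
-- for every φ in A, so a sequent over A holds at ρ' iff its σ-labelled version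
-- holds at ρ. Freeness provides such a ρ' for every ρ and such a ρ for every ρ',
-- so on sequents over A validity and validity of the labelled sequent coincide;
-- the labelled rule is then sound because the unlabelled one is.

module _ {a : Level} (L : Logic a) where
  open Logic L
  open Equivalence

  module _ {ρ ρ' : Eval} {σ : Conf} {A : List Form} (sim : Sim L ρ σ A ρ') where

    all-label⇔ : {Γ : List Form} → Γ ⊆ A →
                 (∀ {φ} → φ ∈ Γ → ρ' ⊨ φ) ⇔ (∀ {ψ} → ψ ∈ label L σ Γ → ρ ⊨ₗ ψ)
    all-label⇔ {Γ} Γ⊆A = mk⇔ labelled unlabelled
      where
      labelled : (∀ {φ} → φ ∈ Γ → ρ' ⊨ φ) → ∀ {ψ} → ψ ∈ label L σ Γ → ρ ⊨ₗ ψ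
      labelled sat ψ∈ with ∈-map⁻ (σ ∶_) ψ∈
      ... | φ , φ∈ , refl = from (sim (Γ⊆A φ∈)) (sat φ∈)

      unlabelled : (∀ {ψ} → ψ ∈ label L σ Γ → ρ ⊨ₗ ψ) → ∀ {φ} → φ ∈ Γ → ρ' ⊨ φ
      unlabelled sat φ∈ = to (sim (Γ⊆A φ∈)) (sat (∈-map⁺ (σ ∶_) φ∈))

    any-label⇔ : {Δ : List Form} → Δ ⊆ A →
                 (∃ λ φ → φ ∈ Δ × ρ' ⊨ φ) ⇔ (∃ λ ψ → ψ ∈ label L σ Δ × ρ ⊨ₗ ψ)
    any-label⇔ {Δ} Δ⊆A = mk⇔ labelled unlabelled
      where
      labelled : (∃ λ φ → φ ∈ Δ × ρ' ⊨ φ) → ∃ λ ψ → ψ ∈ label L σ Δ × ρ ⊨ₗ ψ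
      labelled (φ , φ∈ , sat) = σ ∶ φ , ∈-map⁺ (σ ∶_) φ∈ , from (sim (Δ⊆A φ∈)) sat

      unlabelled : (∃ λ ψ → ψ ∈ label L σ Δ × ρ ⊨ₗ ψ) → ∃ λ φ → φ ∈ Δ × ρ' ⊨ φ
      unlabelled (ψ , ψ∈ , sat) with ∈-map⁻ (σ ∶_) ψ∈
      ... | φ , φ∈ , refl = φ , φ∈ , to (sim (Δ⊆A φ∈)) sat

  Free⇒Valid⇔ValidL : {σ : Conf} {A Γ Δ : List Form} → Free L σ A → Γ ⊆ A → Δ ⊆ A →
                      Valid L Γ Δ ⇔ ValidL L (label L σ Γ) (label L σ Δ)
  Free⇒Valid⇔ValidL (forth , back) Γ⊆A Δ⊆A = mk⇔ labelled unlabelled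
    where
    labelled : Valid L _ _ → ValidL L _ _
    labelled valid ρ satΓ with forth ρ
    ... | ρ' , sim = to (any-label⇔ sim Δ⊆A) (valid ρ' (from (all-label⇔ sim Γ⊆A) satΓ))

    unlabelled : ValidL L _ _ → Valid L _ _
    unlabelled valid ρ' satΓ with back ρ'
    ... | ρ , sim = from (any-label⇔ sim Δ⊆A) (valid ρ (to (all-label⇔ sim Γ⊆A) satΓ))

  module AllFormulas (n : ℕ) (Γs Δs : Fin n → List Form) (Γ Δ : List Form) where

    Γ⊆allFormulas : Γ ⊆ allFormulas L n Γs Δs Γ Δ
    Γ⊆allFormulas = xs⊆xs++ys Γ _

    Δ⊆allFormulas : Δ ⊆ allFormulas L n Γs Δs Γ Δ
    Δ⊆allFormulas = ⊆-trans (xs⊆xs++ys Δ _) (xs⊆ys++xs _ Γ)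

    premise⊆allFormulas : ∀ i → Γs i ++ Δs i ⊆ allFormulas L n Γs Δs Γ Δ
    premise⊆allFormulas i =
      ⊆-trans (λ φ∈ → ∈-concat⁺′ φ∈ (∈-map⁺ (λ j → Γs j ++ Δs j) (∈-allFin i)))
              (⊆-trans (xs⊆ys++xs _ Δ) (xs⊆ys++xs _ Γ))

    Γs⊆allFormulas : ∀ i → Γs i ⊆ allFormulas L n Γs Δs Γ Δ
    Γs⊆allFormulas i = ⊆-trans (xs⊆xs++ys (Γs i) _) (premise⊆allFormulas i)

    Δs⊆allFormulas : ∀ i → Δs i ⊆ allFormulas L n Γs Δs Γ Δ
    Δs⊆allFormulas i = ⊆-trans (xs⊆ys++xs (Δs i) _) (premise⊆allFormulas i)

proposition1 : {a : Level} (L : Logic a) (n : ℕ) → 1 ≤ n →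
    (Γs Δs : Fin n → List (Logic.Form L)) (Γ Δ : List (Logic.Form L)) →
    SoundRule L (Logic._⊨_ L) n Γs Δs Γ Δ →
    (σ : Logic.Conf L) → Free L σ (allFormulas L n Γs Δs Γ Δ) →
    SoundRule L (Logic._⊨ₗ_ L) n (λ i → label L σ (Γs i)) (λ i → label L σ (Δs i))
      (label L σ Γ) (label L σ Δ)
proposition1 L n _ Γs Δs Γ Δ sound σ free validPremises =
  to (Free⇒Valid⇔ValidL L free Γ⊆allFormulas Δ⊆allFormulas)
     (sound λ i → from (Free⇒Valid⇔ValidL L free (Γs⊆allFormulas i) (Δs⊆allFormulas i))
                       (validPremises i))
  where
  open Equivalence
  open AllFormulas L n Γs Δs Γ Δ
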